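{- Let $n\ge3$, $c$ a Coxeter element of $\widehat{\mathfrak S}_n$, $i,j,k\in\{0,\dots,n-1\}$ pairwise distinct and $p,q\in\mathbb N$ with $p\ge\delta_{i>j}$, $q\ge\delta_{j>k}$. Then $\omega_c(\beta_{(i,j)_p},\beta_{(j,k)_q})\ne0$ and its sign depends only on the relative order of $i,j,k$ and on which of $\overline{L_c},\overline{R_c}$ each of them belongs to, as follows: if $i,j,k\in\overline{L_c}$, it is positive exactly when $i<j<k$, $k<i<j$ or $j<k<i$ (and negative when $i<k<j$, $k<j<i$ or $j<i<k$); if $i,j,k\in\overline{R_c}$, it is positive exactly when $i<k<j$, $k<j<i$ or $j<i<k$; in all other cases it is positive if $j\in\overline{L_c}$ and negative if $j\in\overline{R_c}$.
   Context: $\widehat{\mathfrak S}_n$: bijections $w$ of $\mathbb Z$ with $w(k+n)=w(k)+n$, $\sum_{k=1}^nw(k)=\sum_{k=1}^nk$, with simple generators $s_i$ ($0\le i\le n-1$) exchanging $i+mn$ and $i+1+mn$ for all $m$. A Coxeter element $c$ is a product of all $s_i$ once each; $\overline{L_c}=\{x\in\mathbb Z:c(x)>x\}$, $\overline{R_c}=\{x:c(x)<x\}$. $(a,b)_p$ is the affine transposition exchanging $a+mn$ and $b+pn+mn$ for all $m$. $V$ has basis $\alpha_0,\dots,\alpha_{n-1}$, $\delta=\sum_i\alpha_i$; for $0\le a<b\le n$, $\beta_{(a,b)}=\beta_{(b,a)}=\alpha_a+\dots+\alpha_{b-1}$; for $a,b\in\{0,\dots,n-1\}$ distinct and $p\ge\delta_{a>b}$,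 $\beta_{(a,b)_p}=\beta_{(a,b)}+p\delta$ if $a<b$, $\beta_{(a,b)_p}=p\delta-\beta_{(b,a)}$ if $a>b$. $\omega_c$ is the skew-symmetric bilinear form with $\omega_c(\alpha_a,\alpha_b)=\pm1$ when $b-a\equiv\pm1\pmod n$, sign $+$ iff $s_a$ precedes $s_b$ in a reduced word of $c$, and $0$ otherwise. $\delta_P\in\{0,1\}$ is the indicator of $P$. -}

module Defs where

open import Data.Bool using (Bool; true; false; if_then_else_; _∨_)
open import Data.Nat as ℕ using (ℕ; NonZero)
open import Data.Integer as ℤ using (ℤ; +_; _+_; _-_; _*_; -_)
open import Data.Integer.DivMod using (_%ℕ_)
open import Data.Fin as Fin using (Fin; toℕ)
open import Data.Fin.Permutation using (Permutation′; _⟨$⟩ʳ_; _⟨$⟩ˡ_)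
open import Data.List using (List; foldr; map; allFin)
open import Data.Product using (_×_)
open import Data.Sum using (_⊎_)
open import Function using (_∘_; id)
open import Relation.Nullary using (does)

∑ : ∀ {n} → (Fin n → ℤ) → ℤ
∑ {ℕ.zero}  f = + 0
∑ {ℕ.suc n} f = f Fin.zero + ∑ (f ∘ Fin.suc)

toℤ : ∀ {n} → Fin n → ℤ
toℤ a = + toℕ a

-- Simple generator s_a of the affine symmetric group, as a map ℤ → ℤ:
-- exchanges a + m n and a + 1 + m n for all m.
s : ∀ {n} .{{_ : NonZero n}} → Fin n → ℤ → ℤ
s {n} a x =
  if does ((x %ℕ n) ℕ.≟ toℕ a) then x + + 1
  else if does ((x %ℕ n) ℕ.≟ (ℕ.suc (toℕ a) ℕ.% n)) then x - + 1
  else x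

-- A Coxeter element is given by a word using each s_a exactly once:
-- σ : position ↦ generator index (a permutation of Fin n), and
-- c = s_{σ 0} s_{σ 1} ⋯ s_{σ (n-1)}  (composition of maps, rightmost first).
cox : ∀ {n} .{{_ : NonZero n}} → Permutation′ n → ℤ → ℤ
cox {n} σ = foldr (λ a f → s a ∘ f) id (map (σ ⟨$⟩ʳ_) (allFin n))

InL : ∀ {n} .{{_ : NonZero n}} → Permutation′ n → Fin n → Set
InL σ a = toℤ a ℤ.< cox σ (toℤ a)

InR : ∀ {n} .{{_ : NonZero n}} → Permutation′ n → Fin n → Set
InR σ a = cox σ (toℤ a) ℤ.< toℤ a

precedes : ∀ {n} → Permutation′ n → Fin n → Fin n → Bool
precedes σ a b = does (toℕ (σ ⟨$⟩ˡ a) ℕ.<? toℕ (σ ⟨$⟩ˡ b))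

ωα : ∀ {n} .{{_ : NonZero n}} → Permutation′ n → Fin n → Fin n → ℤ
ωα {n} σ a b =
  if does (toℕ b ℕ.≟ (ℕ.suc (toℕ a) ℕ.% n)) ∨ does (toℕ a ℕ.≟ (ℕ.suc (toℕ b) ℕ.% n))
  then (if precedes σ a b then + 1 else - + 1)
  else + 0

-- V = ℤ-span of α_0,…,α_{n-1}, vectors as coordinate functions.
V : ℕ → Set
V n = Fin n → ℤ

ω : ∀ {n} .{{_ : NonZero n}} → Permutation′ n → V n → V n → ℤ
ω σ u v = ∑ (λ a → ∑ (λ b → u a * v b * ωα σ a b))

ind : ℕ → ℕ → ℕ → ℤ
ind l r t = if does (l ℕ.≤? t) Data.Bool.∧ does (t ℕ.<? r) then + 1 else + 0

-- β_{(a,b)_p}: β_{(a,b)} + p δ if a < b, and p δ - β_{(b,a)} if a > b,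
-- where β_{(a,b)} = α_a + … + α_{b-1} for a < b and δ = ∑ α_t.
β : ∀ {n} → Fin n → Fin n → ℕ → V n
β a b p t =
  if does (toℕ a ℕ.<? toℕ b) then + p + ind (toℕ a) (toℕ b) (toℕ t)
  else + p - ind (toℕ b) (toℕ a) (toℕ t)

Cyclic : ∀ {n} → Fin n → Fin n → Fin n → Set
Cyclic i j k = (i Fin.< j × j Fin.< k) ⊎ (k Fin.< i × i Fin.< j) ⊎ (j Fin.< k × k Fin.< i)

Anticyclic : ∀ {n} → Fin n → Fin n → Fin n → Set
Anticyclic i j k = (i Fin.< k × k Fin.< j) ⊎ (k Fin.< j × j Fin.< i) ⊎ (j Fin.< i × i Fin.< k)

module Submission where

-- Only neighbouring simple roots pair non-trivially under ω_c, so after reindexing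
--   ω_c(u, v) = Σ_t side(t) (u(t-1) v(t) - u(t) v(t-1)),
-- where side(t) = ±1 according as s_{t-1} precedes s_t in the word of c (indices mod n).
-- As a function of t, β_{(a,b)_p} is a constant plus the indicator of the cyclic interval [a, b),
-- so its discrete derivative is 𝟙_a - 𝟙_b, and only t ∈ {i, j, k} contribute:
--   ω_c(β_{(i,j)_p}, β_{(j,k)_q}) = side(j) (U + V + 1) - side(i) (V + e) - side(k) (U + e)
-- with U, V ≥ 0 and e = 0 or 1 as (i, j, k) is cyclically or anticyclically ordered.
-- Inspecting the eight choices of signs gives the claim once we know that side(t) = +1 exactly
-- when t ∈ L̄_c. If s_{t-1} precedes s_t, then c first moves t to t + 1 and t never comes back
-- down: a downward step from residue r needs s_{r-1}, which is the generator that produced r.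
-- Symmetrically, t moves down for good when s_t precedes s_{t-1}.

open import Defs
open import Data.Bool as Bool using (Bool; true; false; not; if_then_else_)
open import Data.Bool.Properties using (∨-zeroʳ; ∧-zeroʳ)
open import Data.Empty using (⊥-elim)
open import Data.Fin as Fin using (Fin; zero; suc; toℕ; fromℕ; fromℕ<; inject₁; punchIn)
import Data.Fin.Properties as Finₚ
open import Data.Fin.Properties
  using (toℕ-injective; toℕ-fromℕ; toℕ-fromℕ<; toℕ-inject₁; toℕ<n; ≤fromℕ; punchInᵢ≢i)
open import Data.Fin.Permutation using (Permutation′; permutation; _⟨$⟩ʳ_; _⟨$⟩ˡ_; inverseˡ; inverseʳ)
open import Data.Fin.Relation.Unary.Top using (view; ‵fromℕ; ‵inject₁)
open import Data.Integer as ℤ using (ℤ; +_; -[1+_]; _+_; _-_; _*_; -_; 0ℤ; 1ℤ; -1ℤ)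
open import Data.Integer.DivMod using (_%ℕ_; n%ℕd<d)
import Data.Integer.Properties as ℤP
open import Algebra.Properties.CommutativeMonoid.Sum ℤP.+-0-commutativeMonoid
  using (sum; sum-cong-≗; ∑-distrib-+; ∑-permute; sum-remove; sum-replicate-zero)
open import Data.Integer.Tactic.RingSolver using (solve-∀)
open import Data.List using (List; []; _∷_; _++_; foldr; map; allFin)
open import Data.List.Membership.Propositional using (_∈_)
open import Data.List.Membership.Propositional.Properties using (∈-∃++; ∈-map⁺; ∈-allFin)
open import Data.List.Relation.Binary.Subset.Propositional.Properties using (∷⁺ʳ; xs⊆x∷xs)
open import Data.List.Relation.Unary.All as All using (All; []; _∷_)
open import Data.List.Relation.Unary.All.Properties using (All¬⇒¬Any; ++⁻)
open import Data.List.Relation.Unary.AllPairs as AllPairs using (AllPairs; []; _∷_)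
open import Data.List.Relation.Unary.AllPairs.Properties using (map⁺; tabulate⁺-<)
open import Data.List.Relation.Unary.Any using (here; there)
open import Data.List.Relation.Unary.Unique.Propositional using (Unique)
open import Data.Nat as ℕ using (ℕ; zero; suc; NonZero; _≤_; s≤s; z≤n)
open import Data.Nat.DivMod using (_%_; _mod_; m%n<n; n%n≡0; m<n⇒m%n≡m; m%n%n≡m%n; %-distribˡ-+)
import Data.Nat.Properties as ℕP
open import Data.Product using (_×_; _,_; ∃-syntax; ∃₂; proj₁; proj₂)
open import Data.Sum using (_⊎_; inj₁; inj₂)
open import Function using (_∘_; id; _on_; _⇔_; mk⇔; case_of_)
open import Function.Bundles using (Equivalence)
open import Relation.Binary using (tri<; tri≈; tri>)
open import Relation.Binary.PropositionalEquality
  using (_≡_; _≢_; refl; sym; trans; cong; cong₂; subst; subst₂; module ≡-Reasoning)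
open import Relation.Nullary using (¬_; does; yes; no)
open import Relation.Nullary.Decidable using (dec-true; dec-false; _×-dec_)

-- Cyclic successor on Fin n, residues of integers and the generators s_a

module _ {m : ℕ} where

  private
    n : ℕ
    n = suc m

  prev : Fin n → Fin n
  prev zero    = fromℕ m
  prev (suc a) = inject₁ a

  next : Fin n → Fin n
  next a = suc (toℕ a) mod n

  toℕ-next : ∀ a → toℕ (next a) ≡ suc (toℕ a) % n
  toℕ-next a = toℕ-fromℕ< (m%n<n (suc (toℕ a)) n)

  next-fromℕ : next (fromℕ m) ≡ zero
  next-fromℕ = toℕ-injective (begin
    toℕ (next (fromℕ m))   ≡⟨ toℕ-next (fromℕ m) ⟩
    suc (toℕ (fromℕ m)) % n ≡⟨ cong (λ x → suc x % n) (toℕ-fromℕ m) ⟩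
    n % n                  ≡⟨ n%n≡0 n ⟩
    0                      ∎)
    where open ≡-Reasoning

  next-inject₁ : ∀ (a : Fin m) → next (inject₁ a) ≡ suc a
  next-inject₁ a = toℕ-injective (begin
    toℕ (next (inject₁ a))     ≡⟨ toℕ-next (inject₁ a) ⟩
    suc (toℕ (inject₁ a)) % n  ≡⟨ cong (λ x → suc x % n) (toℕ-inject₁ a) ⟩
    suc (toℕ a) % n            ≡⟨ m<n⇒m%n≡m (s≤s (toℕ<n a)) ⟩
    suc (toℕ a)                ∎)
    where open ≡-Reasoning

  next-prev : ∀ a → next (prev a) ≡ a
  next-prev zero    = next-fromℕ
  next-prev (suc a) = next-inject₁ a

  prev-next : ∀ a → prev (next a) ≡ a
  prev-next a with view a
  ... | ‵fromℕ     = cong prev next-fromℕ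
  ... | ‵inject₁ b = cong prev (next-inject₁ b)

  rotation : Permutation′ n
  rotation = permutation prev next prev-next next-prev

  prev≢id : 1 ≤ m → ∀ a → prev a ≢ a
  prev≢id 1≤m zero    eq = ℕP.<⇒≢ 1≤m (trans (sym (cong toℕ eq)) (toℕ-fromℕ m))
  prev≢id _   (suc a) eq = ℕP.<⇒≢ (ℕP.n<1+n (toℕ a)) (trans (sym (toℕ-inject₁ a)) (cong toℕ eq))

  prev²≢id : 2 ≤ m → ∀ a → prev (prev a) ≢ a
  prev²≢id (s≤s (s≤s _)) zero          ()
  prev²≢id (s≤s (s≤s _)) (suc zero)    ()
  prev²≢id (s≤s (s≤s _)) (suc (suc a)) eq = ℕP.<⇒≢ (ℕP.m<n⇒m<1+n (ℕP.n<1+n (toℕ a)))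
    (trans (sym (trans (toℕ-inject₁ (inject₁ a)) (toℕ-inject₁ a))) (cong toℕ eq))

  next≢prev : 2 ≤ m → ∀ a → next a ≢ prev a
  next≢prev 2≤m a eq = prev²≢id 2≤m a (trans (cong prev (sym eq)) (prev-next a))

  suc-% : ∀ t → suc t % n ≡ suc (t % n) % n
  suc-% t = begin
    (1 ℕ.+ t) % n              ≡⟨ %-distribˡ-+ 1 t n ⟩
    (1 % n ℕ.+ t % n) % n      ≡⟨ cong (λ r → (1 % n ℕ.+ r) % n) (m%n%n≡m%n t n) ⟨
    (1 % n ℕ.+ t % n % n) % n  ≡⟨ %-distribˡ-+ 1 (t % n) n ⟨
    (1 ℕ.+ t % n) % n          ∎
    where open ≡-Reasoning

  -- The library computes -[1+ t ] %ℕ n by cases on suc t % n; negMod (suc t) is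
  -- a single closed form for it (negMod t is the residue of -t).
  negMod : ℕ → ℕ
  negMod t = (n ℕ.∸ t % n) % n

  -[1+]%ℕ : ∀ t → -[1+ t ] %ℕ n ≡ negMod (suc t)
  -[1+]%ℕ t with suc t % n | m%n<n (suc t) n
  ... | zero  | _   = sym (n%n≡0 n)
  ... | suc r | r<n = sym (m<n⇒m%n≡m (ℕP.∸-monoʳ-< {n} {suc r} {0} (s≤s z≤n) (ℕP.<⇒≤ r<n)))

  negMod-step : ∀ r → r ℕ.< n → (n ℕ.∸ r) % n ≡ suc ((n ℕ.∸ suc r % n) % n) % n
  negMod-step r r<n with ℕP.m≤n⇒m<n∨m≡n r<n
  ... | inj₁ 1+r<n = begin
    (n ℕ.∸ r) % n                    ≡⟨ cong (_% n) (ℕP.+-∸-assoc 1 (ℕP.<⇒≤ 1+r<n)) ⟩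
    suc (n ℕ.∸ suc r) % n            ≡⟨ cong (λ x → suc x % n) (m<n⇒m%n≡m n∸1+r<n) ⟨
    suc ((n ℕ.∸ suc r) % n) % n      ≡⟨ cong (λ x → suc ((n ℕ.∸ x) % n) % n) (m<n⇒m%n≡m 1+r<n) ⟨
    suc ((n ℕ.∸ suc r % n) % n) % n  ∎
    where
    open ≡-Reasoning
    n∸1+r<n : n ℕ.∸ suc r ℕ.< n
    n∸1+r<n = ℕP.∸-monoʳ-< {n} {suc r} {0} (s≤s z≤n) (ℕP.<⇒≤ 1+r<n)
  ... | inj₂ refl = begin
    (n ℕ.∸ m) % n                    ≡⟨ cong (_% n) (ℕP.m+n∸n≡m 1 m) ⟩
    1 % n                            ≡⟨ cong (λ x → suc x % n) (n%n≡0 n) ⟨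
    suc (n % n) % n                  ≡⟨ cong (λ x → suc ((n ℕ.∸ x) % n) % n) (n%n≡0 n) ⟨
    suc ((n ℕ.∸ n % n) % n) % n      ∎
    where open ≡-Reasoning

  negMod-suc : ∀ t → negMod t ≡ suc (negMod (suc t)) % n
  negMod-suc t = trans (negMod-step (t % n) (m%n<n t n))
                       (cong (λ x → suc ((n ℕ.∸ x) % n) % n) (sym (suc-% t)))

  %ℕ-suc : ∀ x → (x + 1ℤ) %ℕ n ≡ suc (x %ℕ n) % n
  %ℕ-suc (+ t)         = trans (cong (_% n) (ℕP.+-comm t 1)) (suc-% t)
  %ℕ-suc -[1+ zero ]   = trans (sym (n%n≡0 n))
                           (trans (negMod-suc 0) (cong (λ r → suc r % n) (sym (-[1+]%ℕ 0))))
  %ℕ-suc -[1+ suc t ]  = trans (-[1+]%ℕ t)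
                           (trans (negMod-suc (suc t)) (cong (λ r → suc r % n) (sym (-[1+]%ℕ (suc t)))))

  res : ℤ → Fin n
  res x = fromℕ< (n%ℕd<d x n)

  toℕ-res : ∀ x → toℕ (res x) ≡ x %ℕ n
  toℕ-res x = toℕ-fromℕ< (n%ℕd<d x n)

  res-toℤ : ∀ a → res (toℤ a) ≡ a
  res-toℤ a = toℕ-injective (trans (toℕ-res (toℤ a)) (m<n⇒m%n≡m (toℕ<n a)))

  res-+1 : ∀ x → res (x + 1ℤ) ≡ next (res x)
  res-+1 x = toℕ-injective (begin
    toℕ (res (x + 1ℤ))     ≡⟨ toℕ-res (x + 1ℤ) ⟩
    (x + 1ℤ) %ℕ n          ≡⟨ %ℕ-suc x ⟩
    suc (x %ℕ n) % n       ≡⟨ cong (λ r → suc r % n) (toℕ-res x) ⟨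
    suc (toℕ (res x)) % n  ≡⟨ toℕ-next (res x) ⟨
    toℕ (next (res x))     ∎)
    where open ≡-Reasoning

  res-1 : ∀ x → res (x - 1ℤ) ≡ prev (res x)
  res-1 x = begin
    res (x - 1ℤ)                ≡⟨ prev-next (res (x - 1ℤ)) ⟨
    prev (next (res (x - 1ℤ)))  ≡⟨ cong prev (res-+1 (x - 1ℤ)) ⟨
    prev (res (x - 1ℤ + 1ℤ))    ≡⟨ cong (prev ∘ res) (trans (ℤP.+-assoc x -1ℤ 1ℤ) (ℤP.+-identityʳ x)) ⟩
    prev (res x)                ∎
    where open ≡-Reasoning

  data Move (a : Fin n) (x : ℤ) : ℤ → Set where
    up   : res x ≡ a → Move a x (x + 1ℤ)
    down : res x ≢ a → res x ≡ next a → Move a x (x - 1ℤ)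
    stay : res x ≢ a → res x ≢ next a → Move a x x

  move : ∀ a x → Move a x (s a x)
  move a x with (x %ℕ n) ℕ.≟ toℕ a
  ... | yes r≡a rewrite dec-true ((x %ℕ n) ℕ.≟ toℕ a) r≡a =
    up (toℕ-injective (trans (toℕ-res x) r≡a))
  ... | no r≢a rewrite dec-false ((x %ℕ n) ℕ.≟ toℕ a) r≢a with (x %ℕ n) ℕ.≟ suc (toℕ a) % n
  ...   | yes r≡a+1 rewrite dec-true ((x %ℕ n) ℕ.≟ suc (toℕ a) % n) r≡a+1 =
    down (r≢a ∘ trans (sym (toℕ-res x)) ∘ cong toℕ)
         (toℕ-injective (trans (toℕ-res x) (trans r≡a+1 (sym (toℕ-next a)))))
  ...   | no r≢a+1 rewrite dec-false ((x %ℕ n) ℕ.≟ suc (toℕ a) % n) r≢a+1 =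
    stay (r≢a ∘ trans (sym (toℕ-res x)) ∘ cong toℕ)
         (λ e → r≢a+1 (trans (sym (toℕ-res x)) (trans (cong toℕ e) (toℕ-next a))))

  s-up : ∀ {a x} → res x ≡ a → s a x ≡ x + 1ℤ
  s-up {a} {x} r≡a with s a x | move a x
  ... | _ | up _       = refl
  ... | _ | down r≢a _ = ⊥-elim (r≢a r≡a)
  ... | _ | stay r≢a _ = ⊥-elim (r≢a r≡a)

  s-down : ∀ {a x} → res x ≢ a → res x ≡ next a → s a x ≡ x - 1ℤ
  s-down {a} {x} r≢a r≡next-a with s a x | move a x
  ... | _ | up r≡a      = ⊥-elim (r≢a r≡a)
  ... | _ | down _ _    = refl
  ... | _ | stay _ r≢na = ⊥-elim (r≢na r≡next-a)

  act : List (Fin n) → ℤ → ℤ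
  act = foldr (λ a f → s a ∘ f) id

  act-++ : ∀ u v x → act (u ++ v) x ≡ act u (act v x)
  act-++ []      v x = refl
  act-++ (a ∷ u) v x = cong (s a) (act-++ u v x)

  act-fix : ∀ u x → All (λ a → a ≢ res x × a ≢ prev (res x)) u → act u x ≡ x
  act-fix []      x []                 = refl
  act-fix (a ∷ u) x ((a≢r , a≢pr) ∷ h) rewrite act-fix u x h with s a x | move a x
  ... | _ | up r≡a          = ⊥-elim (a≢r (sym r≡a))
  ... | _ | down _ r≡next-a = ⊥-elim (a≢pr (trans (sym (prev-next a)) (cong prev (sym r≡next-a))))
  ... | _ | stay _ _        = refl

  -- A step down from z needs s_{prev (res z)}; along an upward trajectory that generator
  -- has always been used already, since it is the one that produced the residue of z.
  climb : ∀ u x → Unique (prev (res x) ∷ u) →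
          x ℤ.≤ act u x × prev (res (act u x)) ∈ prev (res x) ∷ u
  climb []      x _                        = ℤP.≤-refl , here refl
  climb (a ∷ u) x ((p≢a ∷ p∉u) ∷ a∉u ∷ u!) with act u x | climb u x (p∉u ∷ u!)
  ... | z | x≤z , pz∈ with s a z | move a z
  ...   | _ | up z≡a          = ℤP.≤-trans x≤z (ℤP.i≤i+j z 1ℤ) ,
                                there (here (trans (cong prev (res-+1 z)) (trans (prev-next (res z)) z≡a)))
  ...   | _ | down _ z≡next-a = ⊥-elim (All¬⇒¬Any ((p≢a ∘ sym) ∷ a∉u)
                                  (subst (_∈ _) (trans (cong prev z≡next-a) (prev-next a)) pz∈))
  ...   | _ | stay _ _        = x≤z , ∷⁺ʳ _ (xs⊆x∷xs u a) pz∈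

  descend : ∀ u x → Unique (res x ∷ u) → act u x ℤ.≤ x × res (act u x) ∈ res x ∷ u
  descend []      x _                        = ℤP.≤-refl , here refl
  descend (a ∷ u) x ((r≢a ∷ r∉u) ∷ a∉u ∷ u!) with act u x | descend u x (r∉u ∷ u!)
  ... | z | z≤x , rz∈ with s a z | move a z
  ...   | _ | up z≡a          = ⊥-elim (All¬⇒¬Any ((r≢a ∘ sym) ∷ a∉u) (subst (_∈ _) z≡a rz∈))
  ...   | _ | down _ z≡next-a = ℤP.i≤j⇒i-k≤j 1ℤ z≤x ,
                                there (here (trans (res-1 z) (trans (cong prev z≡next-a) (prev-next a))))
  ...   | _ | stay _ _        = z≤x , ∷⁺ʳ _ (xs⊆x∷xs u a) rz∈

AllPairs-split : ∀ {A : Set} {R : A → A → Set} ys {g zs} → AllPairs R (ys ++ g ∷ zs) →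
                 AllPairs R ys × All (λ y → R y g) ys × All (R g) zs
AllPairs-split []       (g<zs ∷ _)      = [] , [] , g<zs
AllPairs-split (y ∷ ys) (y<rest ∷ rest) with AllPairs-split ys rest | ++⁻ ys y<rest
... | ys! , ys<g , g<zs | y<ys , y<g ∷ _ = (y<ys ∷ ys!) , (y<g ∷ ys<g) , g<zs

-- Finite sums

∑≡sum : ∀ {k} (f : Fin k → ℤ) → ∑ f ≡ sum f
∑≡sum {zero}  f = refl
∑≡sum {suc k} f = cong (λ x → f zero + x) (∑≡sum (f ∘ suc))

𝟙[_] : ∀ {k} → Fin k → Fin k → ℤ
𝟙[ a ] t = if does (a Fin.≟ t) then 1ℤ else 0ℤ

𝟙-self : ∀ {k} (a : Fin k) → 𝟙[ a ] a ≡ 1ℤ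
𝟙-self a rewrite dec-true (a Fin.≟ a) refl = refl

𝟙-≢ : ∀ {k} {a t : Fin k} → a ≢ t → 𝟙[ a ] t ≡ 0ℤ
𝟙-≢ {a = a} {t} a≢t rewrite dec-false (a Fin.≟ t) a≢t = refl

sum-𝟙 : ∀ {k} (f : Fin k → ℤ) a → sum (λ t → f t * 𝟙[ a ] t) ≡ f a
sum-𝟙 {suc k} f a = begin
  sum g                          ≡⟨ sum-remove {i = a} g ⟩
  g a + sum {k} (g ∘ punchIn a)  ≡⟨ cong₂ _+_ (cong (f a *_) (𝟙-self a)) (sum-cong-≗ vanishes) ⟩
  f a * 1ℤ + sum {k} (λ _ → 0ℤ)  ≡⟨ cong₂ _+_ (ℤP.*-identityʳ (f a)) (sum-replicate-zero k) ⟩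
  f a + 0ℤ                       ≡⟨ ℤP.+-identityʳ (f a) ⟩
  f a                            ∎
  where
  open ≡-Reasoning
  g : Fin (suc k) → ℤ
  g t = f t * 𝟙[ a ] t
  vanishes : ∀ j → g (punchIn a j) ≡ 0ℤ
  vanishes j = trans (cong (f (punchIn a j) *_) (𝟙-≢ (punchInᵢ≢i a j ∘ sym)))
                     (ℤP.*-zeroʳ (f (punchIn a j)))

sgn : Bool → ℤ
sgn b = if b then 1ℤ else -1ℤ

sgn-not : ∀ b → sgn (not b) ≡ - sgn b
sgn-not true  = refl
sgn-not false = refl

-- The roots β

module _ {l r : ℕ} where

  ind-in : ∀ {t} → l ≤ t → t ℕ.< r → ind l r t ≡ 1ℤ
  ind-in {t} l≤t t<r rewrite dec-true (l ℕ.≤? t) l≤t | dec-true (t ℕ.<? r) t<r = refl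

  ind-below : ∀ {t} → t ℕ.< l → ind l r t ≡ 0ℤ
  ind-below {t} t<l rewrite dec-false (l ℕ.≤? t) (ℕP.<⇒≱ t<l) = refl

  ind-above : ∀ {t} → r ≤ t → ind l r t ≡ 0ℤ
  ind-above {t} r≤t rewrite dec-false (t ℕ.<? r) (ℕP.≤⇒≯ r≤t) | ∧-zeroʳ (does (l ℕ.≤? t)) = refl

  ind-suc : ∀ {x} → suc x ≢ l → suc x ≢ r → ind l r (suc x) ≡ ind l r x
  ind-suc {x} 1+x≢l 1+x≢r with ℕ.<-cmp (suc x) l
  ... | tri< 1+x<l _ _ = trans (ind-below 1+x<l) (sym (ind-below (ℕP.<-trans (ℕP.n<1+n x) 1+x<l)))
  ... | tri≈ _ 1+x≡l _ = ⊥-elim (1+x≢l 1+x≡l)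
  ... | tri> _ _ (s≤s l≤x) with ℕ.<-cmp (suc x) r
  ...   | tri< 1+x<r _ _   = trans (ind-in (ℕP.m≤n⇒m≤1+n l≤x) 1+x<r)
                                   (sym (ind-in l≤x (ℕP.<-trans (ℕP.n<1+n x) 1+x<r)))
  ...   | tri≈ _ 1+x≡r _   = ⊥-elim (1+x≢r 1+x≡r)
  ...   | tri> _ _ (s≤s r≤x) = trans (ind-above (ℕP.m≤n⇒m≤1+n r≤x)) (sym (ind-above r≤x))

ind-prev : ∀ {m} {l r : Fin (suc m)} t → l Fin.< r →
           ind (toℕ l) (toℕ r) (toℕ (prev t)) ≡ ind (toℕ l) (toℕ r) (toℕ t) - (𝟙[ l ] t - 𝟙[ r ] t)
ind-prev {l = zero}  {suc r} zero _ = ind-above {l = 0} (≤fromℕ (suc r))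
ind-prev {l = suc l} {suc r} zero _ = ind-above {l = suc (toℕ l)} (≤fromℕ (suc r))
ind-prev {m} {l} {r} (suc t) l<r rewrite toℕ-inject₁ t with l Fin.≟ suc t | r Fin.≟ suc t
... | yes refl | yes refl = ⊥-elim (ℕP.<-irrefl refl l<r)
... | yes refl | no _     = trans (ind-below {r = toℕ r} (ℕP.n<1+n (toℕ t)))
                                  (sym (cong (_- 1ℤ) (ind-in ℕP.≤-refl l<r)))
... | no _     | yes refl = trans (ind-in (ℕP.≤-pred l<r) (ℕP.n<1+n (toℕ t)))
                                  (sym (cong (_- -1ℤ) (ind-above {l = toℕ l} ℕP.≤-refl)))
... | no l≢t   | no r≢t   = trans (sym (ind-suc {x = toℕ t} (l≢t ∘ toℕ-injective ∘ sym)
                                                            (r≢t ∘ toℕ-injective ∘ sym)))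
                                  (sym (ℤP.+-identityʳ _))

module _ {k : ℕ} {a b : Fin k} {p : ℕ} where

  β-< : a Fin.< b → ∀ t → β a b p t ≡ + p + ind (toℕ a) (toℕ b) (toℕ t)
  β-< a<b t rewrite dec-true (toℕ a ℕ.<? toℕ b) a<b = refl

  β-> : b Fin.< a → ∀ t → β a b p t ≡ + p - ind (toℕ b) (toℕ a) (toℕ t)
  β-> b<a t rewrite dec-false (toℕ a ℕ.<? toℕ b) (ℕP.<-asym b<a) = refl

  β-<-target : a Fin.< b → β a b p b ≡ + p
  β-<-target a<b = trans (β-< a<b b) (trans (cong (λ x → + p + x) (ind-above {l = toℕ a} ℕP.≤-refl))
                                             (ℤP.+-identityʳ (+ p)))

  β->-target : b Fin.< a → β a b p b ≡ + p - 1ℤ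
  β->-target b<a = trans (β-> b<a b) (cong (λ x → + p - x) (ind-in ℕP.≤-refl b<a))

  -- β a b p is its value at b plus the indicator of the cyclic interval [a, b).

  β-<-profile : a Fin.< b → ∀ t → β a b p t ≡ β a b p b + ind (toℕ a) (toℕ b) (toℕ t)
  β-<-profile a<b t = trans (β-< a<b t) (cong (_+ ind (toℕ a) (toℕ b) (toℕ t)) (sym (β-<-target a<b)))

  β->-profile : b Fin.< a → ∀ t → β a b p t ≡ β a b p b + (1ℤ - ind (toℕ b) (toℕ a) (toℕ t))
  β->-profile b<a t = trans (β-> b<a t) (trans (regroup (+ p) (ind (toℕ b) (toℕ a) (toℕ t)))
    (cong (_+ (1ℤ - ind (toℕ b) (toℕ a) (toℕ t))) (sym (β->-target b<a))))
    where
    regroup : ∀ x y → x - y ≡ x - 1ℤ + (1ℤ - y)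
    regroup = solve-∀

  β-target : a ≢ b → (b Fin.< a → 1 ≤ p) → ∃[ P ] β a b p b ≡ + P
  β-target a≢b hp with Finₚ.<-cmp a b
  ... | tri< a<b _ _ = p , β-<-target a<b
  ... | tri≈ _ a≡b _ = ⊥-elim (a≢b a≡b)
  ... | tri> _ _ b<a with hp b<a
  ...   | s≤s {n = p′} _ = p′ , β->-target b<a

  β-source : a ≢ b → β a b p a ≡ β a b p b + 1ℤ
  β-source a≢b with Finₚ.<-cmp a b
  ... | tri< a<b _ _ = trans (β-<-profile a<b a) (cong (_+_ (β a b p b)) (ind-in ℕP.≤-refl a<b))
  ... | tri≈ _ a≡b _ = ⊥-elim (a≢b a≡b)
  ... | tri> _ _ b<a = trans (β->-profile b<a a)
                             (cong (λ x → β a b p b + (1ℤ - x)) (ind-above {l = toℕ b} ℕP.≤-refl))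

  β-cyclic : ∀ {c} → Cyclic c a b → β a b p c ≡ β a b p b + 0ℤ
  β-cyclic {c} (inj₁ (c<a , a<b)) =
    trans (β-<-profile a<b c) (cong (_+_ (β a b p b)) (ind-below {r = toℕ b} c<a))
  β-cyclic {c} (inj₂ (inj₁ (b<c , c<a))) =
    trans (β->-profile (ℕP.<-trans b<c c<a) c)
          (cong (λ x → β a b p b + (1ℤ - x)) (ind-in {l = toℕ b} (ℕP.<⇒≤ b<c) c<a))
  β-cyclic {c} (inj₂ (inj₂ (a<b , b<c))) =
    trans (β-<-profile a<b c) (cong (_+_ (β a b p b)) (ind-above {l = toℕ a} (ℕP.<⇒≤ b<c)))

  β-anticyclic : ∀ {c} → Anticyclic c a b → β a b p c ≡ β a b p b + 1ℤ
  β-anticyclic {c} (inj₁ (c<b , b<a)) =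
    trans (β->-profile b<a c) (cong (λ x → β a b p b + (1ℤ - x)) (ind-below {r = toℕ a} c<b))
  β-anticyclic {c} (inj₂ (inj₁ (b<a , a<c))) =
    trans (β->-profile b<a c)
          (cong (λ x → β a b p b + (1ℤ - x)) (ind-above {l = toℕ b} (ℕP.<⇒≤ a<c)))
  β-anticyclic {c} (inj₂ (inj₂ (a<c , c<b))) =
    trans (β-<-profile (ℕP.<-trans a<c c<b) c)
          (cong (_+_ (β a b p b)) (ind-in {l = toℕ a} (ℕP.<⇒≤ a<c) c<b))

β-prev : ∀ {m} {a b : Fin (suc m)} {p} → a ≢ b → ∀ t →
         β a b p (prev t) ≡ β a b p t - (𝟙[ a ] t - 𝟙[ b ] t)
β-prev {a = a} {b} {p} a≢b t with Finₚ.<-cmp a b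
... | tri< a<b _ _ = begin
  β a b p (prev t)       ≡⟨ β-< a<b (prev t) ⟩
  + p + I (prev t)       ≡⟨ cong (λ x → + p + x) (ind-prev t a<b) ⟩
  + p + (I t - jump)     ≡⟨ ℤP.+-assoc (+ p) (I t) (- jump) ⟨
  + p + I t - jump       ≡⟨ cong (_- jump) (β-< a<b t) ⟨
  β a b p t - jump       ∎
  where
  open ≡-Reasoning
  I : Fin _ → ℤ
  I = ind (toℕ a) (toℕ b) ∘ toℕ
  jump = 𝟙[ a ] t - 𝟙[ b ] t
... | tri≈ _ a≡b _ = ⊥-elim (a≢b a≡b)
... | tri> _ _ b<a = begin
  β a b p (prev t)                         ≡⟨ β-> b<a (prev t) ⟩
  + p - I (prev t)                         ≡⟨ cong (λ x → + p - x) (ind-prev t b<a) ⟩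
  + p - (I t - (𝟙[ b ] t - 𝟙[ a ] t))      ≡⟨ flip-jump (+ p) (I t) (𝟙[ a ] t) (𝟙[ b ] t) ⟩
  + p - I t - (𝟙[ a ] t - 𝟙[ b ] t)        ≡⟨ cong (_- (𝟙[ a ] t - 𝟙[ b ] t)) (β-> b<a t) ⟨
  β a b p t - (𝟙[ a ] t - 𝟙[ b ] t)        ∎
  where
  open ≡-Reasoning
  I : Fin _ → ℤ
  I = ind (toℕ b) (toℕ a) ∘ toℕ
  flip-jump : ∀ x y d d′ → x - (y - (d′ - d)) ≡ x - y - (d - d′)
  flip-jump = solve-∀

-- The Coxeter element and the form ω

module _ {m : ℕ} (σ : Permutation′ (suc m)) where

  private
    n : ℕ
    n = suc m

  pos : Fin n → ℕ
  pos a = toℕ (σ ⟨$⟩ˡ a)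

  pos-injective : ∀ {a c} → pos a ≡ pos c → a ≡ c
  pos-injective eq = trans (sym (inverseʳ σ)) (trans (cong (σ ⟨$⟩ʳ_) (toℕ-injective eq)) (inverseʳ σ))

  pos<⇒≢ : ∀ {a t} → pos t ℕ.< pos a → a ≢ t
  pos<⇒≢ t<a a≡t = ℕP.<-irrefl (cong pos (sym a≡t)) t<a

  word : List (Fin n)
  word = map (σ ⟨$⟩ʳ_) (allFin n)

  word-sorted : AllPairs (ℕ._<_ on pos) word
  word-sorted = map⁺ (tabulate⁺-< λ {i} {j} i<j →
    subst₂ ℕ._<_ (sym (cong toℕ (inverseˡ σ {i}))) (sym (cong toℕ (inverseˡ σ {j}))) i<j)

  ∈-word : ∀ g → g ∈ word
  ∈-word g = subst (_∈ word) (inverseʳ σ) (∈-map⁺ (σ ⟨$⟩ʳ_) (∈-allFin (σ ⟨$⟩ˡ g)))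

  word-split : ∀ g → ∃₂ λ ys zs →
               word ≡ ys ++ g ∷ zs × Unique (g ∷ ys) × All (λ a → pos g ℕ.< pos a) zs
  word-split g with ∈-∃++ (∈-word g)
  ... | ys , zs , eq with AllPairs-split ys (subst (AllPairs _) eq word-sorted)
  ... | ys-sorted , ys<g , g<zs =
    ys , zs , eq , All.map pos<⇒≢ ys<g ∷ AllPairs.map (λ y<y′ → pos<⇒≢ y<y′ ∘ sym) ys-sorted , g<zs

  act-fix-toℤ : ∀ (b : Fin n) zs → All (λ a → a ≢ b × a ≢ prev b) zs → act zs (toℤ b) ≡ toℤ b
  act-fix-toℤ b zs =
    act-fix zs (toℤ b) ∘ subst (λ r → All (λ a → a ≢ r × a ≢ prev r) zs) (sym (res-toℤ b))

  prev-first⇒InL : ∀ b → pos (prev b) ℕ.< pos b → InL σ b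
  prev-first⇒InL b prev-first with word-split b
  ... | ys , zs , eq , b∷ys! , b<zs = ℤP.suc[i]≤j⇒i<j (begin
    1ℤ + x                   ≡⟨ ℤP.+-comm 1ℤ x ⟩
    x + 1ℤ                   ≤⟨ proj₁ (climb ys (x + 1ℤ) unique) ⟩
    act ys (x + 1ℤ)          ≡⟨ cong (act ys) (s-up {a = b} {x = x} (res-toℤ b)) ⟨
    act ys (s b x)           ≡⟨ cong (act ys ∘ s b) fixed ⟨
    act ys (s b (act zs x))  ≡⟨ act-++ ys (b ∷ zs) x ⟨
    act (ys ++ b ∷ zs) x     ≡⟨ cong (λ w → act w x) eq ⟨
    cox σ x                  ∎)
    where
    open ℤP.≤-Reasoning
    x = toℤ b
    unique : Unique (prev (res (x + 1ℤ)) ∷ ys)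
    unique = subst (Unique ∘ (_∷ ys)) (sym (trans (cong prev (res-+1 x)) (trans (prev-next (res x)) (res-toℤ b))))
                   b∷ys!
    fixed : act zs x ≡ x
    fixed = act-fix-toℤ b zs (All.map (λ {a} b<a → pos<⇒≢ {a} b<a , pos<⇒≢ {a} (ℕP.<-trans prev-first b<a))
                                      b<zs)

  prev-last⇒InR : ∀ b → pos b ℕ.< pos (prev b) → InR σ b
  prev-last⇒InR b b-first with word-split (prev b)
  ... | ys , zs , eq , pb∷ys! , pb<zs = ℤP.i≤pred[j]⇒i<j (begin
    cox σ x                         ≡⟨ cong (λ w → act w x) eq ⟩
    act (ys ++ prev b ∷ zs) x       ≡⟨ act-++ ys (prev b ∷ zs) x ⟩
    act ys (s (prev b) (act zs x))  ≡⟨ cong (act ys ∘ s (prev b)) fixed ⟩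
    act ys (s (prev b) x)           ≡⟨ cong (act ys) (s-down {a = prev b} {x = x} r≢pb r≡npb) ⟩
    act ys (x - 1ℤ)                 ≤⟨ proj₁ (descend ys (x - 1ℤ) unique) ⟩
    x - 1ℤ                          ≡⟨ ℤP.+-comm x -1ℤ ⟩
    -1ℤ + x                         ∎)
    where
    open ℤP.≤-Reasoning
    x = toℤ b
    r≢pb : res x ≢ prev b
    r≢pb r≡pb = pos<⇒≢ b-first (trans (sym r≡pb) (res-toℤ b))
    r≡npb : res x ≡ next (prev b)
    r≡npb = trans (res-toℤ b) (sym (next-prev b))
    unique : Unique (res (x - 1ℤ) ∷ ys)
    unique = subst (Unique ∘ (_∷ ys)) (sym (trans (res-1 x) (cong prev (res-toℤ b)))) pb∷ys!
    fixed : act zs x ≡ x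
    fixed = act-fix-toℤ b zs (All.map (λ {a} pb<a → pos<⇒≢ {a} (ℕP.<-trans b-first pb<a) , pos<⇒≢ {a} pb<a)
                                      pb<zs)

  InL-or-InR : 1 ≤ m → ∀ b →
               (precedes σ (prev b) b ≡ true × InL σ b) ⊎ (precedes σ (prev b) b ≡ false × InR σ b)
  InL-or-InR 1≤m b with pos (prev b) ℕ.<? pos b
  ... | yes lt rewrite dec-true (pos (prev b) ℕ.<? pos b) lt = inj₁ (refl , prev-first⇒InL b lt)
  ... | no ¬lt rewrite dec-false (pos (prev b) ℕ.<? pos b) ¬lt =
    inj₂ (refl , prev-last⇒InR b (ℕP.≤∧≢⇒< (ℕP.≮⇒≥ ¬lt) (prev≢id 1≤m b ∘ pos-injective ∘ sym)))

  InL⇔prev-first : 1 ≤ m → ∀ b → InL σ b ⇔ (precedes σ (prev b) b ≡ true)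
  InL⇔prev-first 1≤m b with InL-or-InR 1≤m b
  ... | inj₁ (t , l) = mk⇔ (λ _ → t) (λ _ → l)
  ... | inj₂ (f , r) = mk⇔ (λ l → ⊥-elim (ℤP.<-asym l r)) (λ t → case trans (sym t) f of λ ())

  InR⇔prev-last : 1 ≤ m → ∀ b → InR σ b ⇔ (precedes σ (prev b) b ≡ false)
  InR⇔prev-last 1≤m b with InL-or-InR 1≤m b
  ... | inj₁ (t , l) = mk⇔ (λ r → ⊥-elim (ℤP.<-asym l r)) (λ f → case trans (sym t) f of λ ())
  ... | inj₂ (f , r) = mk⇔ (λ _ → f) (λ _ → r)

  side : Fin n → ℤ
  side t = sgn (precedes σ (prev t) t)

  precedes-flip : ∀ {a c} → a ≢ c → precedes σ c a ≡ not (precedes σ a c)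
  precedes-flip {a} {c} a≢c with ℕ.<-cmp (pos a) (pos c)
  ... | tri< a<c _ _ rewrite dec-true (pos a ℕ.<? pos c) a<c | dec-false (pos c ℕ.<? pos a) (ℕP.<-asym a<c)
    = refl
  ... | tri≈ _ a≡c _ = ⊥-elim (a≢c (pos-injective a≡c))
  ... | tri> _ _ c<a rewrite dec-true (pos c ℕ.<? pos a) c<a | dec-false (pos a ℕ.<? pos c) (ℕP.<-asym c<a)
    = refl

  ωα-adjacent : ∀ {a b} → b ≡ next a ⊎ a ≡ next b → ωα σ a b ≡ sgn (precedes σ a b)
  ωα-adjacent {a} {b} (inj₁ b≡na)
    rewrite dec-true (toℕ b ℕ.≟ suc (toℕ a) % n) (trans (cong toℕ b≡na) (toℕ-next a)) = refl
  ωα-adjacent {a} {b} (inj₂ a≡nb)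
    rewrite dec-true (toℕ a ℕ.≟ suc (toℕ b) % n) (trans (cong toℕ a≡nb) (toℕ-next b))
          | ∨-zeroʳ (does (toℕ b ℕ.≟ suc (toℕ a) % n)) = refl

  ωα-far : ∀ {a b} → b ≢ next a → a ≢ next b → ωα σ a b ≡ 0ℤ
  ωα-far {a} {b} b≢na a≢nb
    rewrite dec-false (toℕ b ℕ.≟ suc (toℕ a) % n) (b≢na ∘ toℕ-injective ∘ (λ e → trans e (sym (toℕ-next a))))
          | dec-false (toℕ a ℕ.≟ suc (toℕ b) % n) (a≢nb ∘ toℕ-injective ∘ (λ e → trans e (sym (toℕ-next b))))
          = refl

  ωα-split : 2 ≤ m → ∀ a b → ωα σ a b ≡ 𝟙[ next a ] b * side b + 𝟙[ prev a ] b * - side a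
  ωα-split 2≤m a b with next a Fin.≟ b | prev a Fin.≟ b
  ... | yes na≡b | yes pa≡b = ⊥-elim (next≢prev 2≤m a (trans na≡b (sym pa≡b)))
  ... | yes refl | no _     = begin
    ωα σ a (next a)                     ≡⟨ ωα-adjacent (inj₁ refl) ⟩
    sgn (precedes σ a (next a))         ≡⟨ cong (λ c → sgn (precedes σ c (next a))) (prev-next a) ⟨
    side (next a)                       ≡⟨ trans (ℤP.+-identityʳ _) (ℤP.*-identityˡ _) ⟨
    1ℤ * side (next a) + 0ℤ * - side a  ∎
    where open ≡-Reasoning
  ... | no _     | yes refl = begin
    ωα σ a (prev a)                     ≡⟨ ωα-adjacent (inj₂ (sym (next-prev a))) ⟩
    sgn (precedes σ a (prev a))         ≡⟨ cong sgn (precedes-flip (prev≢id (ℕP.≤-trans (ℕP.n≤1+n 1) 2≤m) a)) ⟩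
    sgn (not (precedes σ (prev a) a))   ≡⟨ sgn-not (precedes σ (prev a) a) ⟩
    - side a                            ≡⟨ trans (ℤP.+-identityˡ _) (ℤP.*-identityˡ _) ⟨
    0ℤ * side (prev a) + 1ℤ * - side a  ∎
    where open ≡-Reasoning
  ... | no na≢b  | no pa≢b  = ωα-far (na≢b ∘ sym) (λ a≡nb → pa≢b (trans (cong prev a≡nb) (prev-next b)))

  ω-adjacent : 2 ≤ m → ∀ u v → ω σ u v ≡ sum (λ t → side t * (u (prev t) * v t - u t * v (prev t)))
  ω-adjacent 2≤m u v = begin
    ω σ u v
      ≡⟨ trans (∑≡sum (λ a → ∑ (W a))) (sum-cong-≗ (∑≡sum ∘ W)) ⟩
    sum (λ a → sum (W a))
      ≡⟨ sum-cong-≗ inner ⟩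
    sum (λ a → X a + Y a)
      ≡⟨ ∑-distrib-+ X Y ⟩
    sum X + sum Y
      ≡⟨ cong (_+ sum Y) rotate ⟩
    sum X′ + sum Y
      ≡⟨ ∑-distrib-+ X′ Y ⟨
    sum (λ t → X′ t + Y t)
      ≡⟨ sum-cong-≗ (λ t → collect (u (prev t)) (v t) (u t) (v (prev t)) (side t)) ⟩
    sum (λ t → side t * (u (prev t) * v t - u t * v (prev t)))
      ∎
    where
    open ≡-Reasoning
    W : Fin n → Fin n → ℤ
    W a b = u a * v b * ωα σ a b
    X Y X′ : Fin n → ℤ
    X a = u a * v (next a) * side (next a)
    Y a = - (u a * v (prev a) * side a)
    X′ t = u (prev t) * v t * side t
    distribute : ∀ x y ε ε′ d d′ → x * y * (d * ε + d′ * - ε′) ≡ x * y * ε * d + - (x * y * ε′) * d′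
    distribute = solve-∀
    collect : ∀ x y x′ y′ ε → x * y * ε + - (x′ * y′ * ε) ≡ ε * (x * y - x′ * y′)
    collect = solve-∀
    inner : ∀ a → sum (W a) ≡ X a + Y a
    inner a = begin
      sum (W a)
        ≡⟨ sum-cong-≗ (λ b → trans (cong (u a * v b *_) (ωα-split 2≤m a b))
                                   (distribute (u a) (v b) (side b) (side a) (𝟙[ next a ] b) (𝟙[ prev a ] b))) ⟩
      sum (λ b → F b * 𝟙[ next a ] b + G b * 𝟙[ prev a ] b)
        ≡⟨ ∑-distrib-+ (λ b → F b * 𝟙[ next a ] b) (λ b → G b * 𝟙[ prev a ] b) ⟩
      sum (λ b → F b * 𝟙[ next a ] b) + sum (λ b → G b * 𝟙[ prev a ] b)
        ≡⟨ cong₂ _+_ (sum-𝟙 F (next a)) (sum-𝟙 G (prev a)) ⟩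
      X a + Y a
        ∎
      where
      F G : Fin n → ℤ
      F b = u a * v b * side b
      G b = - (u a * v b * side a)
    rotate : sum X ≡ sum X′
    rotate = trans (∑-permute X rotation)
                   (sum-cong-≗ (λ t → cong (λ c → u (prev t) * v c * side c) (next-prev t)))

  ω-β-β : 2 ≤ m → ∀ {i j k : Fin n} {p q} → i ≢ j → j ≢ k →
          ω σ (β i j p) (β j k q) ≡
            side j * (β i j p j + β j k q j) - side i * β j k q i - side k * β i j p k
  ω-β-β 2≤m {i} {j} {k} {p} {q} i≢j j≢k = begin
    ω σ u v
      ≡⟨ ω-adjacent 2≤m u v ⟩
    sum (λ t → side t * (u (prev t) * v t - u t * v (prev t)))
      ≡⟨ sum-cong-≗ localise ⟩
    sum (λ t → A t * 𝟙[ j ] t + (B t * 𝟙[ i ] t + C t * 𝟙[ k ] t))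
      ≡⟨ ∑-distrib-+ (λ t → A t * 𝟙[ j ] t) (λ t → B t * 𝟙[ i ] t + C t * 𝟙[ k ] t) ⟩
    sum (λ t → A t * 𝟙[ j ] t) + sum (λ t → B t * 𝟙[ i ] t + C t * 𝟙[ k ] t)
      ≡⟨ cong (_+_ (sum (λ t → A t * 𝟙[ j ] t)))
              (∑-distrib-+ (λ t → B t * 𝟙[ i ] t) (λ t → C t * 𝟙[ k ] t)) ⟩
    sum (λ t → A t * 𝟙[ j ] t) + (sum (λ t → B t * 𝟙[ i ] t) + sum (λ t → C t * 𝟙[ k ] t))
      ≡⟨ cong₂ _+_ (sum-𝟙 A j) (cong₂ _+_ (sum-𝟙 B i) (sum-𝟙 C k)) ⟩
    A j + (B i + C k)
      ≡⟨ reorder (side j) (side i) (side k) (u j + v j) (v i) (u k) ⟩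
    side j * (u j + v j) - side i * v i - side k * u k
      ∎
    where
    open ≡-Reasoning
    u v A B C : Fin n → ℤ
    u = β i j p
    v = β j k q
    A t = side t * (u t + v t)
    B t = - (side t * v t)
    C t = - (side t * u t)
    expand : ∀ ε x y dᵢ dⱼ dₖ → ε * ((x - (dᵢ - dⱼ)) * y - x * (y - (dⱼ - dₖ))) ≡
                                ε * (x + y) * dⱼ + (- (ε * y) * dᵢ + - (ε * x) * dₖ)
    expand = solve-∀
    localise : ∀ t → side t * (u (prev t) * v t - u t * v (prev t)) ≡
                     A t * 𝟙[ j ] t + (B t * 𝟙[ i ] t + C t * 𝟙[ k ] t)
    localise t = trans (cong₂ (λ x y → side t * (x * v t - u t * y)) (β-prev i≢j t) (β-prev j≢k t))
                       (expand (side t) (u t) (v t) (𝟙[ i ] t) (𝟙[ j ] t) (𝟙[ k ] t))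
    reorder : ∀ εⱼ εᵢ εₖ x y z → εⱼ * x + (- (εᵢ * y) + - (εₖ * z)) ≡ εⱼ * x - εᵢ * y - εₖ * z
    reorder = solve-∀

-- Signs

-- ω(β_{(i,j)_p}, β_{(j,k)_q}) as given by ω-β-β, where U and V are the values of the two roots
-- at their targets j and k, and e ∈ {0, 1} records the cyclic orientation of (i, j, k).
Ω : (εᵢ εⱼ εₖ U V e : ℤ) → ℤ
Ω εᵢ εⱼ εₖ U V e = εⱼ * (U + (V + 1ℤ)) - εᵢ * (V + e) - εₖ * (U + e)

Ω-uniform : ∀ {εᵢ εⱼ εₖ s} U V e → εᵢ ≡ s → εⱼ ≡ s → εₖ ≡ s →
            Ω εᵢ εⱼ εₖ U V e ≡ s * (1ℤ - (e + e))
Ω-uniform {s = s} U V e refl refl refl = identity s U V e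
  where
  identity : ∀ s U V e → s * (U + (V + 1ℤ)) - s * (V + e) - s * (U + e) ≡ s * (1ℤ - (e + e))
  identity = solve-∀

Ω-flipᵢ : ∀ s U V e → Ω (- s) s s U V e ≡ s * (1ℤ + (V + V))
Ω-flipᵢ = identity
  where
  identity : ∀ s U V e → s * (U + (V + 1ℤ)) - - s * (V + e) - s * (U + e) ≡ s * (1ℤ + (V + V))
  identity = solve-∀

Ω-flipₖ : ∀ s U V e → Ω s s (- s) U V e ≡ s * (1ℤ + (U + U))
Ω-flipₖ = identity
  where
  identity : ∀ s U V e → s * (U + (V + 1ℤ)) - s * (V + e) - - s * (U + e) ≡ s * (1ℤ + (U + U))
  identity = solve-∀

Ω-flipᵢₖ : ∀ s U V e → Ω (- s) s (- s) U V e ≡ s * (1ℤ + ((U + V + e) + (U + V + e)))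
Ω-flipᵢₖ = identity
  where
  identity : ∀ s U V e →
             s * (U + (V + 1ℤ)) - - s * (V + e) - - s * (U + e) ≡ s * (1ℤ + ((U + V + e) + (U + V + e)))
  identity = solve-∀

Ω-mixed : ∀ bᵢ bⱼ bₖ P Q e → ¬ (bᵢ ≡ bⱼ × bₖ ≡ bⱼ) →
          ∃[ N ] Ω (sgn bᵢ) (sgn bⱼ) (sgn bₖ) (+ P) (+ Q) (+ e) ≡ sgn bⱼ * + suc N
Ω-mixed true  true  true  P Q e uneven = ⊥-elim (uneven (refl , refl))
Ω-mixed false false false P Q e uneven = ⊥-elim (uneven (refl , refl))
Ω-mixed false true  true  P Q e _ = Q ℕ.+ Q , Ω-flipᵢ 1ℤ (+ P) (+ Q) (+ e)
Ω-mixed true  false false P Q e _ = Q ℕ.+ Q , Ω-flipᵢ -1ℤ (+ P) (+ Q) (+ e)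
Ω-mixed true  true  false P Q e _ = P ℕ.+ P , Ω-flipₖ 1ℤ (+ P) (+ Q) (+ e)
Ω-mixed false false true  P Q e _ = P ℕ.+ P , Ω-flipₖ -1ℤ (+ P) (+ Q) (+ e)
Ω-mixed false true  false P Q e _ = (P ℕ.+ Q ℕ.+ e) ℕ.+ (P ℕ.+ Q ℕ.+ e) , Ω-flipᵢₖ 1ℤ (+ P) (+ Q) (+ e)
Ω-mixed true  false true  P Q e _ = (P ℕ.+ Q ℕ.+ e) ℕ.+ (P ℕ.+ Q ℕ.+ e) , Ω-flipᵢₖ -1ℤ (+ P) (+ Q) (+ e)

sgn*suc≢0 : ∀ b N → sgn b * + suc N ≢ 0ℤ
sgn*suc≢0 true  N ()
sgn*suc≢0 false N ()

Ω≢0 : ∀ bᵢ bⱼ bₖ P Q e → e ≤ 1 → Ω (sgn bᵢ) (sgn bⱼ) (sgn bₖ) (+ P) (+ Q) (+ e) ≢ 0ℤ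
Ω≢0 bᵢ bⱼ bₖ P Q e e≤1 with (bᵢ Bool.≟ bⱼ) ×-dec (bₖ Bool.≟ bⱼ)
... | no uneven with Ω-mixed bᵢ bⱼ bₖ P Q e uneven
...   | N , eq = sgn*suc≢0 bⱼ N ∘ trans (sym eq)
Ω≢0 bᵢ bⱼ bₖ P Q e e≤1 | yes (bᵢ≡bⱼ , bₖ≡bⱼ) =
  odd≢0 bⱼ e≤1 ∘ trans (sym (Ω-uniform (+ P) (+ Q) (+ e) (cong sgn bᵢ≡bⱼ) refl (cong sgn bₖ≡bⱼ)))
  where
  odd≢0 : ∀ b {e} → e ≤ 1 → sgn b * (1ℤ - (+ e + + e)) ≢ 0ℤ
  odd≢0 true  z≤n       ()
  odd≢0 true  (s≤s z≤n) ()
  odd≢0 false z≤n       ()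
  odd≢0 false (s≤s z≤n) ()

0<sgn-true : ∀ {b} N → b ≡ true → 0ℤ ℤ.< sgn b * + suc N
0<sgn-true N refl = ℤ.+<+ (s≤s z≤n)

sgn-false<0 : ∀ {b} N → b ≡ false → sgn b * + suc N ℤ.< 0ℤ
sgn-false<0 N refl = ℤ.-<+

all-equal : ∀ {x y z : Bool} → x ≡ y → z ≡ y →
            (x ≡ true × y ≡ true × z ≡ true) ⊎ (x ≡ false × y ≡ false × z ≡ false)
all-equal {y = true}  refl refl = inj₁ (refl , refl , refl)
all-equal {y = false} refl refl = inj₂ (refl , refl , refl)

module _ {k : ℕ} {a b c : Fin k} where

  Cyclic-rotate : Cyclic a b c → Cyclic c a b
  Cyclic-rotate (inj₁ o)        = inj₂ (inj₂ o)
  Cyclic-rotate (inj₂ (inj₁ o)) = inj₁ o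
  Cyclic-rotate (inj₂ (inj₂ o)) = inj₂ (inj₁ o)

  Anticyclic-rotate : Anticyclic a b c → Anticyclic c a b
  Anticyclic-rotate (inj₁ o)        = inj₂ (inj₂ o)
  Anticyclic-rotate (inj₂ (inj₁ o)) = inj₁ o
  Anticyclic-rotate (inj₂ (inj₂ o)) = inj₂ (inj₁ o)

  cyclic⊎anticyclic : a ≢ b → b ≢ c → a ≢ c → Cyclic a b c ⊎ Anticyclic a b c
  cyclic⊎anticyclic a≢b b≢c a≢c with Finₚ.<-cmp a b | Finₚ.<-cmp b c | Finₚ.<-cmp a c
  ... | tri≈ _ a≡b _ | _            | _            = ⊥-elim (a≢b a≡b)
  ... | _            | tri≈ _ b≡c _ | _            = ⊥-elim (b≢c b≡c)
  ... | _            | _            | tri≈ _ a≡c _ = ⊥-elim (a≢c a≡c)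
  ... | tri< a<b _ _ | tri< b<c _ _ | _            = inj₁ (inj₁ (a<b , b<c))
  ... | tri< a<b _ _ | tri> _ _ c<b | tri> _ _ c<a = inj₁ (inj₂ (inj₁ (c<a , a<b)))
  ... | tri< _ _ _   | tri> _ _ c<b | tri< a<c _ _ = inj₂ (inj₁ (a<c , c<b))
  ... | tri> _ _ _   | tri< b<c _ _ | tri> _ _ c<a = inj₁ (inj₂ (inj₂ (b<c , c<a)))
  ... | tri> _ _ b<a | tri< _ _ _   | tri< a<c _ _ = inj₂ (inj₂ (inj₂ (b<a , a<c)))
  ... | tri> _ _ b<a | tri> _ _ c<b | _            = inj₂ (inj₂ (inj₁ (c<b , b<a)))

module Sign-of-ω {m : ℕ} (2≤m : 2 ≤ m) (σ : Permutation′ (suc m)) {i j k : Fin (suc m)}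
                 (i≢j : i ≢ j) (j≢k : j ≢ k) (i≢k : i ≢ k) {p q : ℕ}
                 (hp : j Fin.< i → 1 ≤ p) (hq : k Fin.< j → 1 ≤ q) where

  private
    1≤m : 1 ≤ m
    1≤m = ℕP.≤-trans (ℕP.n≤1+n 1) 2≤m
    u v : V (suc m)
    u = β i j p
    v = β j k q
    P Q : ℕ
    P = proj₁ (β-target i≢j hp)
    Q = proj₁ (β-target j≢k hq)
    W : ℤ
    W = ω σ u v
    Ωσ : ℤ → ℤ
    Ωσ = Ω (side σ i) (side σ j) (side σ k) (+ P) (+ Q)
    b : Fin (suc m) → Bool
    b x = precedes σ (prev x) x

  ω-Ω : ∀ e → v i ≡ v k + e → u k ≡ u j + e → W ≡ Ωσ e
  ω-Ω e vᵢ≡ uₖ≡ = begin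
    W
      ≡⟨ ω-β-β σ 2≤m i≢j j≢k ⟩
    εⱼ * (u j + v j) - εᵢ * v i - εₖ * u k
      ≡⟨ cong₂ (λ x y → εⱼ * (u j + x) - εᵢ * v i - εₖ * y) (β-source j≢k) uₖ≡ ⟩
    εⱼ * (u j + (v k + 1ℤ)) - εᵢ * v i - εₖ * (u j + e)
      ≡⟨ cong (λ x → εⱼ * (u j + (v k + 1ℤ)) - εᵢ * x - εₖ * (u j + e)) vᵢ≡ ⟩
    Ω εᵢ εⱼ εₖ (u j) (v k) e
      ≡⟨ cong₂ (λ U V → Ω εᵢ εⱼ εₖ U V e) (proj₂ (β-target i≢j hp)) (proj₂ (β-target j≢k hq)) ⟩
    Ωσ e
      ∎
    where
    open ≡-Reasoning
    εᵢ εⱼ εₖ : ℤ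
    εᵢ = side σ i
    εⱼ = side σ j
    εₖ = side σ k

  ω-cyclic : Cyclic i j k → W ≡ Ωσ 0ℤ
  ω-cyclic c = ω-Ω 0ℤ (β-cyclic c) (β-cyclic (Cyclic-rotate c))

  ω-anticyclic : Anticyclic i j k → W ≡ Ωσ 1ℤ
  ω-anticyclic a = ω-Ω 1ℤ (β-anticyclic a) (β-anticyclic (Anticyclic-rotate a))

  ω-shape : ∃[ e ] e ≤ 1 × W ≡ Ωσ (+ e)
  ω-shape with cyclic⊎anticyclic i≢j j≢k i≢k
  ... | inj₁ c = 0 , z≤n , ω-cyclic c
  ... | inj₂ a = 1 , s≤s z≤n , ω-anticyclic a

  left : ∀ {x} → InL σ x → side σ x ≡ 1ℤ
  left {x} = cong sgn ∘ Equivalence.to (InL⇔prev-first σ 1≤m x)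

  right : ∀ {x} → InR σ x → side σ x ≡ -1ℤ
  right {x} = cong sgn ∘ Equivalence.to (InR⇔prev-last σ 1≤m x)

  ω≢0 : W ≢ 0ℤ
  ω≢0 with ω-shape
  ... | e , e≤1 , eq = Ω≢0 (b i) (b j) (b k) P Q e e≤1 ∘ trans (sym eq)

  all-left : InL σ i × InL σ j × InL σ k → (Cyclic i j k → 0ℤ ℤ.< W) × (Anticyclic i j k → W ℤ.< 0ℤ)
  all-left (lᵢ , lⱼ , lₖ) =
    (λ c → subst (0ℤ ℤ.<_) (sym (trans (ω-cyclic c) (uniform 0ℤ))) (ℤ.+<+ (s≤s z≤n))) ,
    (λ a → subst (ℤ._< 0ℤ) (sym (trans (ω-anticyclic a) (uniform 1ℤ))) ℤ.-<+)
    where uniform = λ e → Ω-uniform (+ P) (+ Q) e (left lᵢ) (left lⱼ) (left lₖ)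

  all-right : InR σ i × InR σ j × InR σ k → (Anticyclic i j k → 0ℤ ℤ.< W) × (Cyclic i j k → W ℤ.< 0ℤ)
  all-right (rᵢ , rⱼ , rₖ) =
    (λ a → subst (0ℤ ℤ.<_) (sym (trans (ω-anticyclic a) (uniform 1ℤ))) (ℤ.+<+ (s≤s z≤n))) ,
    (λ c → subst (ℤ._< 0ℤ) (sym (trans (ω-cyclic c) (uniform 0ℤ))) ℤ.-<+)
    where uniform = λ e → Ω-uniform (+ P) (+ Q) e (right rᵢ) (right rⱼ) (right rₖ)

  sides-uneven : ¬ (InL σ i × InL σ j × InL σ k) → ¬ (InR σ i × InR σ j × InR σ k) →
                 ¬ (b i ≡ b j × b k ≡ b j)
  sides-uneven ¬L ¬R (bᵢ≡bⱼ , bₖ≡bⱼ) with all-equal bᵢ≡bⱼ bₖ≡bⱼ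
  ... | inj₁ (tᵢ , tⱼ , tₖ) = ¬L (from-left i tᵢ , from-left j tⱼ , from-left k tₖ)
    where from-left = λ x → Equivalence.from (InL⇔prev-first σ 1≤m x)
  ... | inj₂ (fᵢ , fⱼ , fₖ) = ¬R (from-right i fᵢ , from-right j fⱼ , from-right k fₖ)
    where from-right = λ x → Equivalence.from (InR⇔prev-last σ 1≤m x)

  mixed : ¬ (InL σ i × InL σ j × InL σ k) → ¬ (InR σ i × InR σ j × InR σ k) →
          (InL σ j → 0ℤ ℤ.< W) × (InR σ j → W ℤ.< 0ℤ)
  mixed ¬L ¬R with ω-shape
  ... | e , _ , eq with Ω-mixed (b i) (b j) (b k) P Q e (sides-uneven ¬L ¬R)
  ...   | N , eq′ =
    (λ lⱼ → subst (0ℤ ℤ.<_) (sym (trans eq eq′)) (0<sgn-true N (to-left lⱼ))) ,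
    (λ rⱼ → subst (ℤ._< 0ℤ) (sym (trans eq eq′)) (sgn-false<0 N (to-right rⱼ)))
    where
    to-left = Equivalence.to (InL⇔prev-first σ 1≤m j)
    to-right = Equivalence.to (InR⇔prev-last σ 1≤m j)

corollary2p10 : (n : ℕ) .{{_ : NonZero n}} → 3 ≤ n → (σ : Permutation′ n)
    → (i j k : Fin n) → i ≢ j → j ≢ k → i ≢ k
    → (p q : ℕ) → (j Fin.< i → 1 ≤ p) → (k Fin.< j → 1 ≤ q)
    → (ω σ (β i j p) (β j k q) ≢ + 0)
      × ((InL σ i × InL σ j × InL σ k)
          → (Cyclic i j k → + 0 ℤ.< ω σ (β i j p) (β j k q))
            × (Anticyclic i j k → ω σ (β i j p) (β j k q) ℤ.< + 0))
      × ((InR σ i × InR σ j × InR σ k)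
          → (Anticyclic i j k → + 0 ℤ.< ω σ (β i j p) (β j k q))
            × (Cyclic i j k → ω σ (β i j p) (β j k q) ℤ.< + 0))
      × (¬ (InL σ i × InL σ j × InL σ k) → ¬ (InR σ i × InR σ j × InR σ k)
          → (InL σ j → + 0 ℤ.< ω σ (β i j p) (β j k q))
            × (InR σ j → ω σ (β i j p) (β j k q) ℤ.< + 0))
corollary2p10 (suc m) (s≤s 2≤m) σ i j k i≢j j≢k i≢k p q hp hq = ω≢0 , all-left , all-right , mixed
  where open Sign-of-ω 2≤m σ i≢j j≢k i≢k hp hq
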